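{- Let $(a_N)_{N\ge1}$ be Stern's triatomic sequence. The standard tribonacci sequence $1,1,1,3,5,9,17,31,57,105,193,\dots$ (defined by $\beta_1=\beta_2=\beta_3=1$ and $\beta_{m+3}=\beta_m+\beta_{m+1}+\beta_{m+2}$) equals $$a_1,\ a_2,\ a_3,\ a_{\tau(1;3)},\ a_{\tau(1,1;3)},\ \dots,\ a_{\tau(1^s;3)},\ \dots,$$ where $1^s$ denotes the tuple of $s$ ones.
   Context: Let $A_0=\begin{pmatrix}1&0&1\\0&1&1\\0&0&1\end{pmatrix}$, $A_1=\begin{pmatrix}0&0&1\\1&0&1\\0&1&1\end{pmatrix}$, $A_2=\begin{pmatrix}0&1&1\\0&0&1\\1&0&1\end{pmatrix}$. For a tuple $I=(i_1,\dots,i_n)$ with $i_j\in\{0,1,2\}$ ($n\ge0$) set $(v_1(I),v_2(I),v_3(I))=(1,1,1)A_{i_1}\cdots A_{i_n}$. Define $\tau(i_1,\dots,i_n;k)=\frac{3(3^n-1)}{2}+i_13^n+i_23^{n-1}+\cdots+i_n3+k$ for $k\in\{1,2,3\}$; every positive integer is $\tau(I;k)$ for exactly one pair $(I,k)$. Stern's triatomic sequence is $a_{\tau(I;k)}=v_k(I)$. -}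

module Defs where

open import Data.Nat using (ℕ; zero; suc; _+_; _*_; _∸_; _^_; _<ᵇ_; _/_; _%_)
open import Data.Bool using (if_then_else_)
open import Data.Fin using (Fin; zero; suc)
open import Data.List using (List; []; _∷_; _++_; replicate; foldl; length)
open import Data.Product using (_×_; _,_; proj₁; proj₂)

Mat : Set
Mat = Fin 3 → Fin 3 → ℕ

Row : Set
Row = Fin 3 → ℕ

_⊙_ : Row → Mat → Row
(v ⊙ M) j = v zero * M zero j + v (suc zero) * M (suc zero) j + v (suc (suc zero)) * M (suc (suc zero)) j

mk : ℕ → ℕ → ℕ → ℕ → ℕ → ℕ → ℕ → ℕ → ℕ → Mat
mk a b c d e f g h i zero zero = a
mk a b c d e f g h i zero (suc zero) = b
mk a b c d e f g h i zero (suc (suc zero)) = c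
mk a b c d e f g h i (suc zero) zero = d
mk a b c d e f g h i (suc zero) (suc zero) = e
mk a b c d e f g h i (suc zero) (suc (suc zero)) = f
mk a b c d e f g h i (suc (suc zero)) zero = g
mk a b c d e f g h i (suc (suc zero)) (suc zero) = h
mk a b c d e f g h i (suc (suc zero)) (suc (suc zero)) = i

A : Fin 3 → Mat
A zero             = mk 1 0 1  0 1 1  0 0 1
A (suc zero)       = mk 0 0 1  1 0 1  0 1 1
A (suc (suc zero)) = mk 0 1 1  0 0 1  1 0 1

ones : Row
ones _ = 1

v : List (Fin 3) → Row
v I = foldl (λ r i → r ⊙ A i) ones I

digit : Fin 3 → ℕ
digit zero = 0
digit (suc zero) = 1
digit (suc (suc zero)) = 2

digitsVal : List (Fin 3) → ℕ
digitsVal I = 3 * foldl (λ acc i → 3 * acc + digit i) 0 I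

-- τ(I;k) = 3(3ⁿ-1)/2 + i₁3ⁿ + ⋯ + iₙ3 + k, with k ∈ {1,2,3} encoded as Fin 3 (k = toℕ + 1)
τ : List (Fin 3) → Fin 3 → ℕ
τ I k = (3 * (3 ^ length I ∸ 1)) / 2 + digitsVal I + (digit k + 1)

-- Decoding a positive integer N into the unique (I,k) with τ(I;k) = N.
-- With M = N ∸ 1, find the level n (= length I) and the offset r = M - 3(3ⁿ-1)/2 < 3ⁿ⁺¹.
-- level fuel n M : returns (n', r) ; fuel = M suffices.
level : ℕ → ℕ → ℕ → ℕ × ℕ
level zero n M = n , M
level (suc f) n M = if M <ᵇ 3 ^ suc n then (n , M) else level f (suc n) (M ∸ 3 ^ suc n)

toFin3 : ℕ → Fin 3
toFin3 0 = zero
toFin3 1 = suc zero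
toFin3 _ = suc (suc zero)

digits : ℕ → ℕ → List (Fin 3)
digits zero q = []
digits (suc n) q = digits n (q / 3) ++ (toFin3 (q % 3) ∷ [])

decode : ℕ → List (Fin 3) × Fin 3
decode N with level (N ∸ 1) 0 (N ∸ 1)
... | n , r = digits n (r / 3) , toFin3 (r % 3)

-- Stern's triatomic sequence: a_{τ(I;k)} = v_k(I)  (a 0 is a junk value, unused)
a : ℕ → ℕ
a N = v (proj₁ (decode N)) (proj₂ (decode N))

β : ℕ → ℕ
β 0 = 0
β 1 = 1
β 2 = 1
β 3 = 1
β (suc (suc (suc (suc m)))) = β (suc m) + β (suc (suc m)) + β (suc (suc (suc m)))

-- τ and the decoding of indices are mutually inverse: the level n = length I is found by
-- peeling off the blocks of sizes 3, 9, 27, … that precede it (they sum to 3(3ⁿ − 1)/2), and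
-- the remainder 3·i₁…iₙ + (k − 1) < 3ⁿ⁺¹ is read back in base 3. Hence a_{τ(I;k)} = v_k(I).
-- Right multiplication by A₁ sends (x, y, z) to (y, z, x + y + z), one step of the tribonacci
-- recurrence, so (1,1,1)A₁ˢ = (β_{s+1}, β_{s+2}, β_{s+3}) and a_{τ(1ˢ;3)} = β_{s+3}.
module Submission where

open import Defs
open import Data.Nat using (ℕ; zero; suc; _+_; _*_; _∸_; _^_; _<ᵇ_; _/_; _%_; _≤_; _<_; z≤n; s≤s; z<s; s<s; NonZero)
open import Data.Nat.Properties
open import Data.Nat.DivMod using (+-distrib-/-∣ʳ; m<n⇒m/n≡0; m*n/n≡m; [m+kn]%n≡m%n; m<n⇒m%n≡m)
open import Data.Nat.Divisibility using (n∣m*n)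
open import Data.Nat.Tactic.RingSolver using (solve-∀)
open import Data.Bool using (true; false)
open import Data.Fin using (Fin; zero; suc)
open import Data.List using (List; _∷ʳ_; foldl; length; replicate)
open import Data.List.Properties using (length-++; foldl-∷ʳ)
open import Data.List.Reverse using (Reverse; []; _∶_∶ʳ_; reverseView)
open import Data.Product using (_×_; _,_; proj₂)
open import Relation.Binary.PropositionalEquality
  using (_≡_; refl; sym; trans; cong; cong₂; subst; subst₂; module ≡-Reasoning)
open import Relation.Nullary using (contradiction)

[m*n+k]/n≡m : ∀ m {n k} .{{_ : NonZero n}} → k < n → (m * n + k) / n ≡ m
[m*n+k]/n≡m m {n} {k} k<n = begin
  (m * n + k) / n   ≡⟨ cong (_/ n) (+-comm (m * n) k) ⟩
  (k + m * n) / n   ≡⟨ +-distrib-/-∣ʳ k (n∣m*n m) ⟩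
  k / n + m * n / n ≡⟨ cong₂ _+_ (m<n⇒m/n≡0 k<n) (m*n/n≡m m n) ⟩
  m                 ∎
  where open ≡-Reasoning

[m*n+k]%n≡k : ∀ m {n k} .{{_ : NonZero n}} → k < n → (m * n + k) % n ≡ k
[m*n+k]%n≡k m {n} {k} k<n = begin
  (m * n + k) % n ≡⟨ cong (_% n) (+-comm (m * n) k) ⟩
  (k + m * n) % n ≡⟨ [m+kn]%n≡m%n k m n ⟩
  k % n           ≡⟨ m<n⇒m%n≡m k<n ⟩
  k               ∎
  where open ≡-Reasoning

m<o∧k<n⇒m*n+k<o*n : ∀ {m o k n} → m < o → k < n → m * n + k < o * n
m<o∧k<n⇒m*n+k<o*n {m} {o} {k} {n} m<o k<n = begin-strict
  m * n + k ≡⟨ +-comm (m * n) k ⟩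
  k + m * n <⟨ +-monoˡ-< (m * n) k<n ⟩
  suc m * n ≤⟨ *-monoˡ-≤ n m<o ⟩
  o * n     ∎
  where open ≤-Reasoning

digit<3 : ∀ i → digit i < 3
digit<3 zero             = z<s
digit<3 (suc zero)       = s<s z<s
digit<3 (suc (suc zero)) = s<s (s<s z<s)

toFin3-digit : ∀ i → toFin3 (digit i) ≡ i
toFin3-digit zero             = refl
toFin3-digit (suc zero)       = refl
toFin3-digit (suc (suc zero)) = refl

-- The number with base-3 digits i₁ … iₙ; digitsVal I is definitionally 3 * fromDigits I.
fromDigits : List (Fin 3) → ℕ
fromDigits = foldl (λ acc i → 3 * acc + digit i) 0

length-∷ʳ : ∀ {A : Set} (xs : List A) x → length (xs ∷ʳ x) ≡ suc (length xs)
length-∷ʳ xs x = trans (length-++ xs) (+-comm (length xs) 1)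

fromDigits-∷ʳ : ∀ xs x → fromDigits (xs ∷ʳ x) ≡ fromDigits xs * 3 + digit x
fromDigits-∷ʳ xs x = trans (foldl-∷ʳ _ 0 x xs) (cong (_+ digit x) (*-comm 3 (fromDigits xs)))

fromDigits<3^length : ∀ xs → fromDigits xs < 3 ^ length xs
fromDigits<3^length xs = go (reverseView xs)
  where
  go : ∀ {xs} → Reverse xs → fromDigits xs < 3 ^ length xs
  go []               = z<s
  go (xs ∶ rs ∶ʳ x) = subst₂ _<_ (sym (fromDigits-∷ʳ xs x))
    (trans (*-comm (3 ^ length xs) 3) (cong (3 ^_) (sym (length-∷ʳ xs x))))
    (m<o∧k<n⇒m*n+k<o*n (go rs) (digit<3 x))

digits-fromDigits : ∀ xs → digits (length xs) (fromDigits xs) ≡ xs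
digits-fromDigits xs = go (reverseView xs)
  where
  go : ∀ {xs} → Reverse xs → digits (length xs) (fromDigits xs) ≡ xs
  go []               = refl
  go (xs ∶ rs ∶ʳ x) = begin
    digits (length (xs ∷ʳ x)) (fromDigits (xs ∷ʳ x))
      ≡⟨ cong₂ digits (length-∷ʳ xs x) (fromDigits-∷ʳ xs x) ⟩
    digits (length xs) ((F * 3 + digit x) / 3) ∷ʳ toFin3 ((F * 3 + digit x) % 3)
      ≡⟨ cong₂ (λ q k → digits (length xs) q ∷ʳ toFin3 k) ([m*n+k]/n≡m F (digit<3 x)) ([m*n+k]%n≡k F (digit<3 x)) ⟩
    digits (length xs) F ∷ʳ toFin3 (digit x)
      ≡⟨ cong₂ _∷ʳ_ (go rs) (toFin3-digit x) ⟩
    xs ∷ʳ x ∎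
    where
    open ≡-Reasoning
    F = fromDigits xs

-- The base-3 repunit 11…1 (n ones), i.e. (3ⁿ − 1)/2.
repunit : ℕ → ℕ
repunit zero    = 0
repunit (suc n) = 1 + 3 * repunit n

3^n≡2*repunit+1 : ∀ n → 3 ^ n ≡ 2 * repunit n + 1
3^n≡2*repunit+1 zero    = refl
3^n≡2*repunit+1 (suc n) = trans (cong (3 *_) (3^n≡2*repunit+1 n)) (lemma (repunit n))
  where
  lemma : ∀ x → 3 * (2 * x + 1) ≡ 2 * (1 + 3 * x) + 1
  lemma = solve-∀

3*[3^n∸1]/2≡3*repunit : ∀ n → 3 * (3 ^ n ∸ 1) / 2 ≡ 3 * repunit n
3*[3^n∸1]/2≡3*repunit n = begin
  3 * (3 ^ n ∸ 1) / 2             ≡⟨ cong (λ m → 3 * (m ∸ 1) / 2) (3^n≡2*repunit+1 n) ⟩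
  3 * (2 * repunit n + 1 ∸ 1) / 2 ≡⟨ cong (λ m → 3 * m / 2) (m+n∸n≡m (2 * repunit n) 1) ⟩
  3 * (2 * repunit n) / 2         ≡⟨ cong (_/ 2) (lemma (repunit n)) ⟩
  3 * repunit n * 2 / 2           ≡⟨ m*n/n≡m (3 * repunit n) 2 ⟩
  3 * repunit n                   ∎
  where
  open ≡-Reasoning
  lemma : ∀ x → 3 * (2 * x) ≡ 3 * x * 2
  lemma = solve-∀

3*repunit-suc : ∀ n → 3 * repunit (suc n) ≡ 3 ^ suc n + 3 * repunit n
3*repunit-suc n = trans (lemma (repunit n)) (cong (λ m → 3 * m + 3 * repunit n) (sym (3^n≡2*repunit+1 n)))
  where
  lemma : ∀ x → 3 * (1 + 3 * x) ≡ 3 * (2 * x + 1) + 3 * x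
  lemma = solve-∀

repunit-mono-≤ : ∀ {m n} → m ≤ n → repunit m ≤ repunit n
repunit-mono-≤ z≤n       = z≤n
repunit-mono-≤ (s≤s m≤n) = s≤s (*-monoʳ-≤ 3 (repunit-mono-≤ m≤n))

n≤repunit : ∀ n → n ≤ repunit n
n≤repunit zero    = z≤n
n≤repunit (suc n) = s≤s (≤-trans (n≤repunit n) (m≤n*m (repunit n) 3))

level-stop : ∀ f n M → M < 3 ^ suc n → level (suc f) n M ≡ (n , M)
level-stop f n M M< with M <ᵇ 3 ^ suc n | <⇒<ᵇ M<
... | true  | _  = refl
... | false | ()

level-skip : ∀ f n M → 3 ^ suc n ≤ M → level (suc f) n M ≡ level f (suc n) (M ∸ 3 ^ suc n)
level-skip f n M ≤M with M <ᵇ 3 ^ suc n | <ᵇ⇒< M (3 ^ suc n)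
... | false | _  = refl
... | true  | M< = contradiction (M< _) (≤⇒≯ ≤M)

-- The levels below j fill the first 3 * repunit j positions and level j the next 3 ^ suc j
-- (3*repunit-suc), so M positions past the start of level j lie at offset r in level j + d.
level-offset : ∀ {f d} j M r → d ≤ f → r < 3 ^ suc (j + d) →
               M + 3 * repunit j ≡ 3 * repunit (j + d) + r → level f j M ≡ (j + d , r)
level-offset {zero} {zero} j M r _ _ eq rewrite +-identityʳ j =
  cong (j ,_) (+-cancelʳ-≡ (3 * repunit j) M r (trans eq (+-comm (3 * repunit j) r)))
level-offset {suc f} {zero} j M r _ r< eq rewrite +-identityʳ j =
  trans (level-stop f j M (subst (_< 3 ^ suc j) (sym M≡r) r<)) (cong (j ,_) M≡r)
  where
  M≡r : M ≡ r
  M≡r = +-cancelʳ-≡ (3 * repunit j) M r (trans eq (+-comm (3 * repunit j) r))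
level-offset {suc f} {suc d} j M r (s≤s d≤f) r< eq rewrite +-suc j d =
  trans (level-skip f j M block≤M) (level-offset (suc j) (M ∸ 3 ^ suc j) r d≤f r< eq′)
  where
  open ≤-Reasoning
  block≤M : 3 ^ suc j ≤ M
  block≤M = +-cancelʳ-≤ (3 * repunit j) (3 ^ suc j) M (begin
    3 ^ suc j + 3 * repunit j    ≡⟨ 3*repunit-suc j ⟨
    3 * repunit (suc j)          ≤⟨ *-monoʳ-≤ 3 (repunit-mono-≤ (m≤m+n (suc j) d)) ⟩
    3 * repunit (suc j + d)      ≤⟨ m≤m+n _ r ⟩
    3 * repunit (suc j + d) + r  ≡⟨ eq ⟨
    M + 3 * repunit j            ∎)
  eq′ : M ∸ 3 ^ suc j + 3 * repunit (suc j) ≡ 3 * repunit (suc j + d) + r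
  eq′ = begin-equality
    M ∸ 3 ^ suc j + 3 * repunit (suc j)           ≡⟨ cong (M ∸ 3 ^ suc j +_) (3*repunit-suc j) ⟩
    M ∸ 3 ^ suc j + (3 ^ suc j + 3 * repunit j)   ≡⟨ +-assoc (M ∸ 3 ^ suc j) (3 ^ suc j) (3 * repunit j) ⟨
    M ∸ 3 ^ suc j + 3 ^ suc j + 3 * repunit j     ≡⟨ cong (_+ 3 * repunit j) (m∸n+n≡m block≤M) ⟩
    M + 3 * repunit j                             ≡⟨ eq ⟩
    3 * repunit (suc j + d) + r                   ∎

τ≡suc : ∀ I k → τ I k ≡ suc (3 * repunit (length I) + (fromDigits I * 3 + digit k))
τ≡suc I k =
  trans (cong (λ m → m + 3 * fromDigits I + (digit k + 1)) (3*[3^n∸1]/2≡3*repunit (length I)))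
        (lemma (3 * repunit (length I)) (fromDigits I) (digit k))
  where
  lemma : ∀ o q i → o + 3 * q + (i + 1) ≡ suc (o + (q * 3 + i))
  lemma = solve-∀

decode-suc : ∀ K {n r} → level K 0 K ≡ (n , r) → decode (suc K) ≡ (digits n (r / 3) , toFin3 (r % 3))
decode-suc K eq rewrite eq = refl

decode-τ : ∀ I k → decode (τ I k) ≡ (I , k)
decode-τ I k = begin
  decode (τ I k)                      ≡⟨ cong decode (τ≡suc I k) ⟩
  decode (suc K)                      ≡⟨ decode-suc K (level-offset 0 K r n≤K r<3^[1+n] (+-identityʳ K)) ⟩
  (digits n (r / 3) , toFin3 (r % 3)) ≡⟨ cong₂ _,_ (cong (digits n) ([m*n+k]/n≡m F (digit<3 k)))
                                                     (cong toFin3 ([m*n+k]%n≡k F (digit<3 k))) ⟩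
  (digits n F , toFin3 (digit k))     ≡⟨ cong₂ _,_ (digits-fromDigits I) (toFin3-digit k) ⟩
  (I , k)                             ∎
  where
  open ≡-Reasoning
  n = length I
  F = fromDigits I
  r = F * 3 + digit k
  K = 3 * repunit n + r
  n≤K : n ≤ K
  n≤K = ≤-trans (n≤repunit n) (≤-trans (m≤n*m (repunit n) 3) (m≤m+n (3 * repunit n) r))
  r<3^[1+n] : r < 3 ^ suc n
  r<3^[1+n] = subst (r <_) (*-comm (3 ^ n) 3) (m<o∧k<n⇒m*n+k<o*n (fromDigits<3^length I) (digit<3 k))

a-τ : ∀ I k → a (τ I k) ≡ v I k
a-τ I k = cong (λ (J , j) → v J j) (decode-τ I k)

TribonacciWindow : ℕ → Row → Set
TribonacciWindow m r = r zero ≡ β (1 + m) × r (suc zero) ≡ β (2 + m) × r (suc (suc zero)) ≡ β (3 + m)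

⊙-A₁ : ∀ r → (r ⊙ A (suc zero)) zero ≡ r (suc zero)
           × (r ⊙ A (suc zero)) (suc zero) ≡ r (suc (suc zero))
           × (r ⊙ A (suc zero)) (suc (suc zero)) ≡ r zero + r (suc zero) + r (suc (suc zero))
⊙-A₁ r = shift₀ x y z , shift₁ x y z , shift₂ x y z
  where
  x = r zero
  y = r (suc zero)
  z = r (suc (suc zero))
  shift₀ : ∀ x y z → x * 0 + y * 1 + z * 0 ≡ y
  shift₀ = solve-∀
  shift₁ : ∀ x y z → x * 0 + y * 0 + z * 1 ≡ z
  shift₁ = solve-∀
  shift₂ : ∀ x y z → x * 1 + y * 1 + z * 1 ≡ x + y + z
  shift₂ = solve-∀

window-step : ∀ {m r} → TribonacciWindow m r → TribonacciWindow (suc m) (r ⊙ A (suc zero))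
window-step {r = r} (e₀ , e₁ , e₂) =
  let s₀ , s₁ , s₂ = ⊙-A₁ r
  in trans s₀ e₁ , trans s₁ e₂ , trans s₂ (cong₂ _+_ (cong₂ _+_ e₀ e₁) e₂)

applyAll : Row → List (Fin 3) → Row
applyAll = foldl (λ r i → r ⊙ A i)

window-iterate : ∀ n {m r} → TribonacciWindow m r →
                 TribonacciWindow (n + m) (applyAll r (replicate n (suc zero)))
window-iterate zero    w = w
window-iterate (suc n) {m} {r} w =
  subst (λ k → TribonacciWindow k (applyAll (r ⊙ A (suc zero)) (replicate n (suc zero))))
        (+-suc n m) (window-iterate n (window-step {m} {r} w))

v[1ⁿ]₃≡β[3+n] : ∀ n → v (replicate n (suc zero)) (suc (suc zero)) ≡ β (3 + n)
v[1ⁿ]₃≡β[3+n] n = trans (proj₂ (proj₂ (window-iterate n {0} {ones} (refl , refl , refl))))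
                    (cong (λ k → β (3 + k)) (+-identityʳ n))

mainTheorem5 : (β 1 ≡ a 1) × (β 2 ≡ a 2) × (β 3 ≡ a 3)
    × (∀ (s : ℕ) → β (3 + suc s) ≡ a (τ (replicate (suc s) (suc zero)) (suc (suc zero))))
mainTheorem5 = refl , refl , refl , λ s →
  sym (trans (a-τ (replicate (suc s) (suc zero)) (suc (suc zero))) (v[1ⁿ]₃≡β[3+n] (suc s)))
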